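{- Let $k\geq 3$ and $n\geq 2k-3$. Then $q^{p}_k(n)\geq n/2+1$ if $n$ is even, and $q^{p}_k(n)\geq \lfloor n/2\rfloor$ if $n$ is odd.
   Context: There are $n$ balls with distinct identities, each colored with one of two colors; the coloring is unknown to a questioner. A color is the majority color if strictly more than half of the balls have it. The majority problem is: determine with certainty whether a majority color exists, and if it does, output a ball of the majority color. The questioner may adaptively ask $k$-queries in the Pairing model: choose a set of $k$ distinct balls; the answer is YES if all $k$ balls have the same color, and otherwise NO together with two balls of the queried set having different colors (the oracle chooses which such pair; answers are consistent with the hidden coloring and may be adversarial). $q^{p}_k(n)$ denotes the minimum number of such queries that suffice in the worst case to solve the majority problem for $n$ balls. -}

module Defs where

open import Data.Nat using (ℕ; zero; suc; _*_; _<_)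
open import Data.Bool using (Bool; _≟_)
open import Data.Fin using (Fin)
open import Data.Fin.Subset using (Subset; _∈_; ∣_∣)
open import Data.List using (length; filter; allFin)
open import Data.Maybe using (Maybe; just; nothing)
open import Data.Product using (Σ; _×_; _,_)
open import Data.Empty using (⊥)
open import Relation.Nullary using (¬_)
open import Relation.Binary.PropositionalEquality using (_≡_; _≢_)

Coloring : ℕ → Set
Coloring n = Fin n → Bool

count : ∀ {n} → Coloring n → Bool → ℕ
count {n} c b = length (filter (λ i → c i ≟ b) (allFin n))

IsMajority : ∀ {n} → Coloring n → Bool → Set
IsMajority {n} c b = n < 2 * count c b

Query : ℕ → ℕ → Set
Query n k = Σ (Subset n) (λ S → ∣ S ∣ ≡ k)

data Answer (n : ℕ) : Set where
  yes : Answer n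
  no  : Fin n → Fin n → Answer n

Valid : ∀ {n k} → Coloring n → Query n k → Answer n → Set
Valid c (S , _) yes = ∀ i j → i ∈ S → j ∈ S → c i ≡ c j
Valid c (S , _) (no i j) = i ∈ S × j ∈ S × c i ≢ c j

-- Output: nothing = "there is no majority color"; just i = "ball i has the majority color"
Output : ℕ → Set
Output n = Maybe (Fin n)

Correct : ∀ {n} → Coloring n → Output n → Set
Correct c nothing = ∀ b → ¬ IsMajority c b
Correct c (just i) = IsMajority c (c i)

data Strategy (n k : ℕ) : Set where
  leaf  : Output n → Strategy n k
  query : (S : Query n k) → (Answer n → Strategy n k) → Strategy n k

-- Strategy T, run on hidden coloring c against any admissible (possibly adversarial)
-- answers, asks at most q queries and always outputs a correct answer.
Works : ∀ {n k} → Coloring n → Strategy n k → ℕ → Set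
Works c (leaf o) q = Correct c o
Works c (query S f) zero = ⊥
Works c (query S f) (suc q) = ∀ a → Valid c S a → Works c (f a) q

Solves : ∀ {n k} → Strategy n k → ℕ → Set
Solves {n} T q = ∀ (c : Coloring n) → Works c T q

-- The adversary maintains a partial colouring whose two revealed colour classes differ in size
-- by at most one. A query meeting a hidden ball is answered NO with a bichromatic pair, revealing
-- at most two hidden balls; any other query is answered from the revealed colours. As long as one
-- ball is hidden, and two when the revealed classes are equal, every output is refuted by a
-- suitable colouring of the hidden balls, so each query costs the querier at most two hidden
-- balls. For even n parity gains one more query: two balls are revealed only from a tilted state
-- or from an all-hidden query of k ≥ 3 balls, and in both cases a hidden ball remains.
module Submission where

open import Defs
open import Data.Bool using (Bool; true; false; not; if_then_else_) renaming (_≟_ to _≟ᵇ_)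
open import Data.Bool.Properties using (not-¬)
open import Data.Empty using (⊥-elim)
open import Data.Fin using (Fin; zero; suc; punchIn) renaming (_≟_ to _≟ᶠ_)
open import Data.Fin.Properties using (any?; punchInᵢ≢i)
open import Data.Fin.Subset using (Subset; _∈_; ∣_∣; ⁅_⁆; inside; outside)
open import Data.Fin.Subset.Properties using (_∈?_; p⊆q⇒∣p∣≤∣q∣; ∣⁅x⁆∣≡1; x∈⁅x⁆)
open import Data.List using (length; filter; tabulate)
open import Data.Maybe using (Maybe; just; nothing; fromMaybe)
open import Data.Maybe.Properties using (≡-dec; just-injective)
open import Data.Nat using (ℕ; zero; suc; _+_; _*_; _∸_; _≤_; _<_; z≤n; s≤s)
open import Data.Nat.Properties
open import Algebra.Properties.CommutativeMonoid.Sum +-0-commutativeMonoid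
  using (sum; sum-cong-≗; ∑-distrib-+; sum-remove; sum-replicate-zero)
open import Data.Nat.Tactic.RingSolver using (solve-∀)
open import Data.Product using (∃; _×_; _,_; proj₁; proj₂)
open import Data.Sum using (_⊎_; inj₁; inj₂; map₁)
open import Data.Vec using (_∷_; []; here; there)
open import Data.Vec.Functional using (updateAt)
open import Data.Vec.Functional.Properties using (updateAt-updates; updateAt-minimal)
open import Function using (_∘_; id)
open import Relation.Binary.Definitions using (DecidableEquality)
open import Relation.Binary.PropositionalEquality
open import Relation.Nullary using (¬_; Dec; does; contradiction)
open import Relation.Nullary.Decidable as Dec using (_×-dec_; ¬?; decidable-stable)
open import Relation.Unary using (Pred) renaming (Decidable to Decidable₁)

open ≡-Reasoning

indicator : ∀ {P : Set} → Dec P → ℕ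
indicator d = if does d then 1 else 0

sum-ones : ∀ n → sum {n} (λ _ → 1) ≡ n
sum-ones zero    = refl
sum-ones (suc n) = cong suc (sum-ones n)

sum-update : ∀ {n} (f g : Fin n → ℕ) (a : Fin n) → (∀ i → i ≢ a → f i ≡ g i) →
             sum f + g a ≡ sum g + f a
sum-update {suc n} f g a agree = begin
  sum f + g a                          ≡⟨ cong (_+ g a) (sum-remove {i = a} f) ⟩
  f a + sum (f ∘ punchIn a) + g a      ≡⟨ cong (λ s → f a + s + g a) (sum-cong-≗ off-a) ⟩
  f a + sum (g ∘ punchIn a) + g a      ≡⟨ swap-ends (f a) _ (g a) ⟩
  g a + sum (g ∘ punchIn a) + f a      ≡⟨ cong (_+ f a) (sum-remove {i = a} g) ⟨
  sum g + f a                          ∎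
  where
    off-a : ∀ j → f (punchIn a j) ≡ g (punchIn a j)
    off-a j = agree (punchIn a j) (punchInᵢ≢i a j)
    swap-ends : ∀ x s y → x + s + y ≡ y + s + x
    swap-ends = solve-∀

sum-concentrated : ∀ {n} (f : Fin n → ℕ) (a : Fin n) → (∀ i → i ≢ a → f i ≡ 0) → sum f ≡ f a
sum-concentrated {n} f a vanish = begin
  sum f                   ≡⟨ +-identityʳ (sum f) ⟨
  sum f + 0               ≡⟨ sum-update f (λ _ → 0) a vanish ⟩
  sum {n} (λ _ → 0) + f a ≡⟨ cong (_+ f a) (sum-replicate-zero n) ⟩
  f a                     ∎

card≤sum : ∀ {n} (p : Subset n) (g : Fin n → ℕ) → (∀ {i} → i ∈ p → 1 ≤ g i) → ∣ p ∣ ≤ sum g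
card≤sum []            g pos = z≤n
card≤sum (inside ∷ p)  g pos = +-mono-≤ (pos here) (card≤sum p (g ∘ suc) (pos ∘ there))
card≤sum (outside ∷ p) g pos = ≤-trans (card≤sum p (g ∘ suc) (pos ∘ there)) (m≤n+m _ (g zero))

length-filter-tabulate : ∀ {n} {A : Set} {P : Pred A _} (P? : Decidable₁ P) (f : Fin n → A) →
                         length (filter P? (tabulate f)) ≡ sum (λ i → indicator (P? (f i)))
length-filter-tabulate {zero}  P? f = refl
length-filter-tabulate {suc n} P? f with does (P? (f zero))
... | true  = cong suc (length-filter-tabulate P? (f ∘ suc))
... | false = length-filter-tabulate P? (f ∘ suc)

module _ {A : Set} (_≟ᴬ_ : DecidableEquality A) where

  occurrences : ∀ {n} → (Fin n → A) → A → ℕ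
  occurrences f x = sum (λ i → indicator (f i ≟ᴬ x))

  indicator-≡ : ∀ x → indicator (x ≟ᴬ x) ≡ 1
  indicator-≡ x with x ≟ᴬ x
  ... | Dec.yes _  = refl
  ... | Dec.no x≢x = contradiction refl x≢x

  indicator-≢ : ∀ {x y} → x ≢ y → indicator (x ≟ᴬ y) ≡ 0
  indicator-≢ {x} {y} x≢y with x ≟ᴬ y
  ... | Dec.yes x≡y = contradiction x≡y x≢y
  ... | Dec.no _    = refl

  occurrences-updateAt : ∀ {n} (f : Fin n → A) a y x →
    occurrences (updateAt f a (λ _ → y)) x + indicator (f a ≟ᴬ x) ≡ occurrences f x + indicator (y ≟ᴬ x)
  occurrences-updateAt f a y x = begin
    occurrences f′ x + indicator (f a ≟ᴬ x)  ≡⟨ sum-update _ _ a agree ⟩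
    occurrences f x + indicator (f′ a ≟ᴬ x)
      ≡⟨ cong (λ z → occurrences f x + indicator (z ≟ᴬ x)) (updateAt-updates a f) ⟩
    occurrences f x + indicator (y ≟ᴬ x)     ∎
    where
      f′ = updateAt f a (λ _ → y)
      agree : ∀ i → i ≢ a → indicator (f′ i ≟ᴬ x) ≡ indicator (f i ≟ᴬ x)
      agree i i≢a = cong (λ z → indicator (z ≟ᴬ x)) (updateAt-minimal i a f i≢a)

count-occurrences : ∀ {n} (c : Coloring n) b → count c b ≡ occurrences _≟ᵇ_ c b
count-occurrences c b = length-filter-tabulate (λ i → c i ≟ᵇ b) id

Partial : ℕ → Set
Partial n = Fin n → Maybe Bool

_≟ₘ_ : DecidableEquality (Maybe Bool)
_≟ₘ_ = ≡-dec _≟ᵇ_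

revealed : ∀ {n} → Partial n → Bool → ℕ
revealed st b = occurrences _≟ₘ_ st (just b)

hidden : ∀ {n} → Partial n → ℕ
hidden st = occurrences _≟ₘ_ st nothing

Extends : ∀ {n} → Partial n → Coloring n → Set
Extends st c = ∀ {i b} → st i ≡ just b → c i ≡ b

complete : ∀ {n} → Partial n → Bool → Coloring n
complete st γ i = fromMaybe γ (st i)

complete-extends : ∀ {n} (st : Partial n) γ → Extends st (complete st γ)
complete-extends st γ {i} st-i rewrite st-i = refl

reveal : ∀ {n} → Partial n → Fin n → Bool → Partial n
reveal st a b = updateAt st a (λ _ → just b)

partition : ∀ {n} (st : Partial n) β → revealed st β + revealed st (not β) + hidden st ≡ n
partition {n} st β = begin
  revealed st β + revealed st (not β) + hidden st
    ≡⟨ cong (_+ hidden st) (∑-distrib-+ (ind (just β)) (ind (just (not β)))) ⟨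
  sum (λ i → ind (just β) i + ind (just (not β)) i) + hidden st
    ≡⟨ ∑-distrib-+ (λ i → ind (just β) i + ind (just (not β)) i) (ind nothing) ⟨
  sum (λ i → ind (just β) i + ind (just (not β)) i + ind nothing i)
    ≡⟨ sum-cong-≗ (λ i → one-value β (st i)) ⟩
  sum {n} (λ _ → 1)
    ≡⟨ sum-ones n ⟩
  n ∎
  where
    ind : Maybe Bool → Fin n → ℕ
    ind v i = indicator (st i ≟ₘ v)
    one-value : ∀ β x →
      indicator (x ≟ₘ just β) + indicator (x ≟ₘ just (not β)) + indicator (x ≟ₘ nothing) ≡ 1
    one-value true  nothing      = refl
    one-value true  (just true)  = refl
    one-value true  (just false) = refl
    one-value false nothing      = refl
    one-value false (just true)  = refl
    one-value false (just false) = refl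

count-complete-same : ∀ {n} (st : Partial n) γ → count (complete st γ) γ ≡ revealed st γ + hidden st
count-complete-same st γ = begin
  count (complete st γ) γ  ≡⟨ count-occurrences (complete st γ) γ ⟩
  sum (λ i → indicator (complete st γ i ≟ᵇ γ))
    ≡⟨ sum-cong-≗ (λ i → pointwise γ (st i)) ⟩
  sum (λ i → indicator (st i ≟ₘ just γ) + indicator (st i ≟ₘ nothing))
    ≡⟨ ∑-distrib-+ (λ i → indicator (st i ≟ₘ just γ)) (λ i → indicator (st i ≟ₘ nothing)) ⟩
  revealed st γ + hidden st ∎
  where
    pointwise : ∀ γ x →
      indicator (fromMaybe γ x ≟ᵇ γ) ≡ indicator (x ≟ₘ just γ) + indicator (x ≟ₘ nothing)
    pointwise true  nothing      = refl
    pointwise true  (just true)  = refl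
    pointwise true  (just false) = refl
    pointwise false nothing      = refl
    pointwise false (just true)  = refl
    pointwise false (just false) = refl

count-complete-other : ∀ {n} (st : Partial n) β → count (complete st (not β)) β ≡ revealed st β
count-complete-other st β =
  trans (count-occurrences (complete st (not β)) β) (sum-cong-≗ (λ i → pointwise β (st i)))
  where
    pointwise : ∀ β x → indicator (fromMaybe (not β) x ≟ᵇ β) ≡ indicator (x ≟ₘ just β)
    pointwise true  nothing      = refl
    pointwise true  (just true)  = refl
    pointwise true  (just false) = refl
    pointwise false nothing      = refl
    pointwise false (just true)  = refl
    pointwise false (just false) = refl

module _ {n} (st : Partial n) (a : Fin n) (b : Bool) (a-hidden : st a ≡ nothing) where

  private
    occurrences-reveal : ∀ x → occurrences _≟ₘ_ (reveal st a b) x + indicator (nothing ≟ₘ x)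
                             ≡ occurrences _≟ₘ_ st x + indicator (just b ≟ₘ x)
    occurrences-reveal x = begin
      occurrences _≟ₘ_ (reveal st a b) x + indicator (nothing ≟ₘ x)
        ≡⟨ cong (λ z → occurrences _≟ₘ_ (reveal st a b) x + indicator (z ≟ₘ x)) a-hidden ⟨
      occurrences _≟ₘ_ (reveal st a b) x + indicator (st a ≟ₘ x)
        ≡⟨ occurrences-updateAt _≟ₘ_ st a (just b) x ⟩
      occurrences _≟ₘ_ st x + indicator (just b ≟ₘ x) ∎

  revealed-reveal : revealed (reveal st a b) b ≡ suc (revealed st b)
  revealed-reveal = begin
    revealed (reveal st a b) b      ≡⟨ +-identityʳ _ ⟨
    revealed (reveal st a b) b + 0  ≡⟨ occurrences-reveal (just b) ⟩
    revealed st b + indicator (just b ≟ₘ just b) ≡⟨ cong (revealed st b +_) (indicator-≡ _≟ₘ_ (just b)) ⟩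
    revealed st b + 1               ≡⟨ +-comm _ 1 ⟩
    suc (revealed st b)             ∎

  revealed-reveal-≢ : ∀ {b′} → b ≢ b′ → revealed (reveal st a b) b′ ≡ revealed st b′
  revealed-reveal-≢ {b′} b≢b′ = begin
    revealed (reveal st a b) b′      ≡⟨ +-identityʳ _ ⟨
    revealed (reveal st a b) b′ + 0  ≡⟨ occurrences-reveal (just b′) ⟩
    revealed st b′ + indicator (just b ≟ₘ just b′)
      ≡⟨ cong (revealed st b′ +_) (indicator-≢ _≟ₘ_ (b≢b′ ∘ just-injective)) ⟩
    revealed st b′ + 0               ≡⟨ +-identityʳ _ ⟩
    revealed st b′                   ∎

  hidden-reveal : hidden st ≡ suc (hidden (reveal st a b))
  hidden-reveal = begin
    hidden st                        ≡⟨ +-identityʳ _ ⟨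
    hidden st + 0                    ≡⟨ occurrences-reveal nothing ⟨
    hidden (reveal st a b) + 1       ≡⟨ +-comm _ 1 ⟩
    suc (hidden (reveal st a b))     ∎

  reveal-refines : ∀ {c} → Extends (reveal st a b) c → Extends st c
  reveal-refines ext {i} st-i with i ≟ᶠ a
  ... | Dec.yes refl = contradiction (trans (sym a-hidden) st-i) λ ()
  ... | Dec.no i≢a   = ext (trans (updateAt-minimal i a st i≢a) st-i)

reveal-colours : ∀ {n} (st : Partial n) a b {c} → Extends (reveal st a b) c → c a ≡ b
reveal-colours st a b ext = ext (updateAt-updates a st)

Near : ℕ → ℕ → Set
Near x y = x ≤ suc y × y ≤ suc x

Near-sym : ∀ {x y} → Near x y → Near y x
Near-sym (x≤1+y , y≤1+x) = y≤1+x , x≤1+y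

Balanced : ∀ {n} → Partial n → Set
Balanced st = Near (revealed st true) (revealed st false)

module _ {P : ℕ → ℕ → Set} (P-sym : ∀ {x y} → P x y → P y x) (r : Bool → ℕ) where

  orient : ∀ β → P (r true) (r false) → P (r β) (r (not β))
  orient true  = id
  orient false = P-sym

  unorient : ∀ β → P (r β) (r (not β)) → P (r true) (r false)
  unorient true  = id
  unorient false = P-sym

larger-colour : (r : Bool → ℕ) → ∃ λ γ → r (not γ) ≤ r γ
larger-colour r with ≤-total (r false) (r true)
... | inj₁ f≤t = true , f≤t
... | inj₂ t≤f = false , t≤f

smaller-colour : (r : Bool → ℕ) → ∃ λ γ → r γ ≤ r (not γ)
smaller-colour r with ≤-total (r true) (r false)
... | inj₁ t≤f = true , t≤f
... | inj₂ f≤t = false , f≤t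

majority-bound : ∀ {x y u} → y ≤ x → 1 ≤ u → x + y + u < 2 * (x + u)
majority-bound {x} {y} {u} y≤x 1≤u =
  subst₂ _<_ (reorder x u y) (cong ((x + u) +_) (sym (+-identityʳ (x + u))))
    (+-monoʳ-< (x + u) (≤-<-trans y≤x (m<m+n x 1≤u)))
  where
    reorder : ∀ x u y → x + u + y ≡ x + y + u
    reorder = solve-∀

minority-bound : ∀ {x y u} → x ≤ y + u → 2 * x ≤ x + y + u
minority-bound {x} {y} {u} x≤y+u =
  subst₂ _≤_ (cong (x +_) (sym (+-identityʳ x))) (sym (+-assoc x y u)) (+-monoʳ-≤ x x≤y+u)

tie-break : ∀ {x y u} → x ≤ y → (x ≡ y → 2 ≤ suc u) → suc x ≤ y + u
tie-break {x} {y} {u} x≤y tie with m≤n⇒m<n∨m≡n x≤y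
... | inj₁ x<y  = ≤-trans x<y (m≤m+n y u)
... | inj₂ refl = subst (_≤ x + u) (+-comm x 1) (+-monoʳ-≤ x (≤-pred (tie refl)))

refute-revealed : ∀ {n} {st : Partial n} {i β} → st i ≡ just β →
                  revealed st β ≤ revealed st (not β) + hidden st →
                  ¬ Correct (complete st (not β)) (just i)
refute-revealed {n} {st} {i} {β} st-i bound majority =
  <⇒≱ (subst (λ z → n < 2 * z) (trans (cong (count c) c-i) (count-complete-other st β)) majority)
      (subst (2 * revealed st β ≤_) (partition st β) (minority-bound bound))
  where
    c = complete st (not β)
    c-i = complete-extends st (not β) st-i

refute-hidden : ∀ {n} {st : Partial n} {i} → st i ≡ nothing →
                (revealed st true ≡ revealed st false → 2 ≤ hidden st) →
                ∃ λ c → Extends st c × ¬ Correct c (just i)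
refute-hidden {st = st} {i} i-hidden tie with smaller-colour (revealed st)
... | γ , γ-smaller =
  complete st′ (not γ) , reveal-refines st i γ i-hidden (complete-extends st′ (not γ)) ,
  refute-revealed {st = st′} (updateAt-updates i st) bound
  where
    st′ = reveal st i γ
    tie-γ : revealed st γ ≡ revealed st (not γ) → 2 ≤ hidden st
    tie-γ = orient {P = λ x y → x ≡ y → 2 ≤ hidden st} (λ t e → t (sym e)) (revealed st) γ tie
    bound : revealed st′ γ ≤ revealed st′ (not γ) + hidden st′
    bound = subst₂ (λ x y → x ≤ y + hidden st′)
              (sym (revealed-reveal st i γ i-hidden)) (sym (revealed-reveal-≢ st i γ i-hidden (not-¬ refl)))
              (tie-break γ-smaller (subst (2 ≤_) (hidden-reveal st i γ i-hidden) ∘ tie-γ))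

refute : ∀ {n} {st : Partial n} → Balanced st → 1 ≤ hidden st →
         (revealed st true ≡ revealed st false → 2 ≤ hidden st) →
         (o : Output n) → ∃ λ c → Extends st c × ¬ Correct c o
refute {n} {st} bal 1≤h tie nothing with larger-colour (revealed st)
... | γ , γ-larger = complete st γ , complete-extends st γ , λ correct → correct γ majority
  where
    majority : n < 2 * count (complete st γ) γ
    majority = subst₂ (λ x y → x < 2 * y) (partition st γ) (sym (count-complete-same st γ))
                 (majority-bound γ-larger 1≤h)
refute {st = st} bal 1≤h tie (just i) with st i in st-i
... | nothing = refute-hidden {st = st} st-i tie
... | just β  = complete st (not β) , complete-extends st (not β) , refute-revealed {st = st} st-i bound
  where
    bound : revealed st β ≤ revealed st (not β) + hidden st
    bound = ≤-trans (proj₁ (orient {P = Near} Near-sym (revealed st) β bal))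
                    (subst (_≤ revealed st (not β) + hidden st) (+-comm (revealed st (not β)) 1)
                      (+-monoʳ-≤ (revealed st (not β)) 1≤h))

another-member : ∀ {n} {S : Subset n} (a : Fin n) → 2 ≤ ∣ S ∣ → ∃ λ a′ → a′ ∈ S × a′ ≢ a
another-member {S = S} a 2≤∣S∣ with any? (λ i → (i ∈? S) ×-dec ¬? (i ≟ᶠ a))
... | Dec.yes found = found
... | Dec.no none   = ⊥-elim (<⇒≱ 2≤∣S∣ (subst (∣ S ∣ ≤_) (∣⁅x⁆∣≡1 a) (p⊆q⇒∣p∣≤∣q∣ S⊆⁅a⁆)))
  where
    S⊆⁅a⁆ : ∀ {i} → i ∈ S → i ∈ ⁅ a ⁆
    S⊆⁅a⁆ {i} i∈S =
      subst (_∈ ⁅ a ⁆) (sym (decidable-stable (i ≟ᶠ a) (λ i≢a → none (i , i∈S , i≢a)))) (x∈⁅x⁆ a)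

another-hidden : ∀ {n} (st : Partial n) {a} → st a ≡ nothing → 2 ≤ hidden st →
                 ∃ λ v → v ≢ a × st v ≡ nothing
another-hidden st {a} a-hidden 2≤h with any? (λ v → ¬? (v ≟ᶠ a) ×-dec (st v ≟ₘ nothing))
... | Dec.yes found = found
... | Dec.no none   = ⊥-elim (<⇒≱ 2≤h (≤-reflexive only-a))
  where
    only-a : hidden st ≡ 1
    only-a = trans (sum-concentrated (λ i → indicator (st i ≟ₘ nothing)) a
                     (λ v v≢a → indicator-≢ _≟ₘ_ (λ v-hidden → none (v , v≢a , v-hidden))))
                   (cong (λ x → indicator (x ≟ₘ nothing)) a-hidden)

members≤hidden : ∀ {n} (st : Partial n) {S : Subset n} → (∀ {i} → i ∈ S → st i ≡ nothing) →
                 ∣ S ∣ ≤ hidden st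
members≤hidden st {S} all-hidden = card≤sum S (λ i → indicator (st i ≟ₘ nothing))
  (λ i∈S → subst (λ x → 1 ≤ indicator (x ≟ₘ nothing)) (sym (all-hidden i∈S)) ≤-refl)

data Shape {n} (st : Partial n) (S : Subset n) : Set where
  hidden-and-revealed : ∀ {a b β} → a ∈ S → st a ≡ nothing → b ∈ S → st b ≡ just β → Shape st S
  all-hidden          : ∀ {a} → a ∈ S → (∀ {i} → i ∈ S → st i ≡ nothing) → Shape st S
  both-colours        : ∀ {b b′} → b ∈ S → st b ≡ just true → b′ ∈ S → st b′ ≡ just false → Shape st S
  monochrome          : ∀ {β} → (∀ {i} → i ∈ S → st i ≡ just β) → Shape st S

meets? : ∀ {n} (st : Partial n) (S : Subset n) v → Dec (∃ λ i → i ∈ S × st i ≡ v)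
meets? st S v = any? (λ i → (i ∈? S) ×-dec (st i ≟ₘ v))

neither-colour : ∀ {x : Maybe Bool} → x ≢ just true → x ≢ just false → x ≡ nothing
neither-colour {nothing}    _   _   = refl
neither-colour {just true}  ≢t  _   = contradiction refl ≢t
neither-colour {just false} _   ≢f  = contradiction refl ≢f

only-colour : ∀ {x : Maybe Bool} β → x ≢ nothing → x ≢ just (not β) → x ≡ just β
only-colour {nothing}    β     ≢h _   = contradiction refl ≢h
only-colour {just true}  true  _  _   = refl
only-colour {just false} false _  _   = refl
only-colour {just true}  false _  ≢nβ = contradiction refl ≢nβ
only-colour {just false} true  _  ≢nβ = contradiction refl ≢nβ

shape : ∀ {n} (st : Partial n) (S : Subset n) → Shape st S
shape st S with meets? st S nothing | meets? st S (just true) | meets? st S (just false)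
... | Dec.yes (_ , a∈S , a-h) | Dec.yes (_ , b∈S , b-t) | _ = hidden-and-revealed a∈S a-h b∈S b-t
... | Dec.yes (_ , a∈S , a-h) | Dec.no _ | Dec.yes (_ , b∈S , b-f) = hidden-and-revealed a∈S a-h b∈S b-f
... | Dec.yes (_ , a∈S , _) | Dec.no none-t | Dec.no none-f =
  all-hidden a∈S λ {i} i∈S → neither-colour (λ e → none-t (i , i∈S , e)) (λ e → none-f (i , i∈S , e))
... | Dec.no _ | Dec.yes (_ , b∈S , b-t) | Dec.yes (_ , b′∈S , b′-f) = both-colours b∈S b-t b′∈S b′-f
... | Dec.no none-h | Dec.yes _ | Dec.no none-f =
  monochrome λ {i} i∈S → only-colour true (λ e → none-h (i , i∈S , e)) (λ e → none-f (i , i∈S , e))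
... | Dec.no none-h | Dec.no none-t | _ =
  monochrome λ {i} i∈S → only-colour false (λ e → none-h (i , i∈S , e)) (λ e → none-t (i , i∈S , e))

-- G t f u q: t and f balls revealed in the two colours, u balls hidden, q queries left.
record AdversaryInvariant (G : ℕ → ℕ → ℕ → ℕ → Set) : Set where
  field
    swap       : ∀ {t f u q} → G t f u q → G f t u q
    leaf-ok    : ∀ {t f u q} → G t f u q → 1 ≤ u × (t ≡ f → 2 ≤ u)
    idle       : ∀ {t f u q} → G t f u (suc q) → G t f u q
    two≤hidden : ∀ {t f u q} → G t f u (suc q) → 2 ≤ u
    reveal-one : ∀ {t f u q} → G t f (suc u) (suc q) → G t (suc f) u q
    reveal-two : ∀ {t f u q} → G t f (2 + u) (suc q) → 1 ≤ u ⊎ suc t ≡ f → G (suc t) (suc f) u q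

distinct-colours : ∀ {n} {c : Coloring n} {a b β} → c a ≡ not β → c b ≡ β → c a ≢ c b
distinct-colours ca cb ca≡cb = not-¬ refl (sym (trans (sym ca) (trans ca≡cb cb)))

module Adversary {n k : ℕ} (3≤k : 3 ≤ k) {G} (invariant : AdversaryInvariant G) where
  open AdversaryInvariant invariant

  Holds : Partial n → ℕ → Set
  Holds st q = G (revealed st true) (revealed st false) (hidden st) q

  holds-at : ∀ β st {u q} → hidden st ≡ u → Holds st q → G (revealed st β) (revealed st (not β)) u q
  holds-at β st {q = q} refl = orient {P = λ x y → G x y (hidden st) q} swap (revealed st) β

  settle : ∀ β (st : Partial n) {t f u q} →
           revealed st β ≡ t → revealed st (not β) ≡ f → hidden st ≡ u →
           Near t f → G t f u q → Balanced st × Holds st q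
  settle β st {q = q} refl refl refl near g =
    unorient {P = Near} Near-sym (revealed st) β near ,
    unorient {P = λ x y → G x y (hidden st) q} swap (revealed st) β g

  record Reply (st : Partial n) (Q : Query n k) (q : ℕ) : Set where
    constructor reply
    field
      answer  : Answer n
      next    : Partial n
      refines : ∀ {c} → Extends next c → Extends st c
      valid   : ∀ {c} → Extends next c → Valid c Q answer
      settled : Balanced next × Holds next q

  reply-reveal-one : ∀ {st S q a b β} {∣S∣≡k : ∣ S ∣ ≡ k} →
    a ∈ S → st a ≡ nothing → b ∈ S → st b ≡ just β → revealed st (not β) ≤ revealed st β →
    Balanced st → Holds st (suc q) → Reply st (S , ∣S∣≡k) q
  reply-reveal-one {st} {S} {q} {a} {b} {β} {∣S∣≡k} a∈S a-h b∈S b-β ≤β bal hold =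
    reply (no a b) st′ (reveal-refines st a (not β) a-h) valid
      (settle β st′ count-β count-¬β refl (m≤n⇒m≤1+n (proj₁ near) , s≤s ≤β)
         (reveal-one (holds-at β st (hidden-reveal st a (not β) a-h) hold)))
    where
      st′ : Partial n
      st′ = reveal st a (not β)
      near : Near (revealed st β) (revealed st (not β))
      near = orient {P = Near} Near-sym (revealed st) β bal
      valid : ∀ {c} → Extends st′ c → Valid c (S , ∣S∣≡k) (no a b)
      valid {c} ext = a∈S , b∈S , distinct-colours {c = c}
        (reveal-colours st a (not β) ext) (reveal-refines st a (not β) a-h ext b-β)
      count-β : revealed st′ β ≡ revealed st β
      count-β = revealed-reveal-≢ st a (not β) a-h (not-¬ refl ∘ sym)
      count-¬β : revealed st′ (not β) ≡ suc (revealed st (not β))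
      count-¬β = revealed-reveal st a (not β) a-h

  reply-reveal-two : ∀ {st S q a v b β} {∣S∣≡k : ∣ S ∣ ≡ k} →
    a ∈ S → st a ≡ nothing → v ≢ a → st v ≡ nothing → b ∈ S → st b ≡ just β ⊎ b ≡ v →
    3 ≤ hidden st ⊎ suc (revealed st β) ≡ revealed st (not β) →
    Balanced st → Holds st (suc q) → Reply st (S , ∣S∣≡k) q
  reply-reveal-two {st} {S} {q} {a} {v} {b} {β} {∣S∣≡k} a∈S a-h v≢a v-h b∈S b-coloured room bal hold =
    reply (no a b) st″ refines valid
      (settle β st″ count-β count-¬β refl (s≤s (proj₁ near) , s≤s (proj₂ near))
         (reveal-two (holds-at β st hidden-st hold) room′))
    where
      st′ st″ : Partial n
      st′ = reveal st a (not β)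
      st″ = reveal st′ v β
      v-h′ : st′ v ≡ nothing
      v-h′ = trans (updateAt-minimal v a st v≢a) v-h
      refines : ∀ {c} → Extends st″ c → Extends st c
      refines = reveal-refines st a (not β) a-h ∘ reveal-refines st′ v β v-h′
      a-colour : ∀ {c} → Extends st″ c → c a ≡ not β
      a-colour ext = reveal-colours st a (not β) (reveal-refines st′ v β v-h′ ext)
      b-colour : ∀ {c} → st b ≡ just β ⊎ b ≡ v → Extends st″ c → c b ≡ β
      b-colour (inj₁ b-β) ext = refines ext b-β
      b-colour (inj₂ refl) ext = reveal-colours st′ v β ext
      valid : ∀ {c} → Extends st″ c → Valid c (S , ∣S∣≡k) (no a b)
      valid {c} ext = a∈S , b∈S , distinct-colours {c = c} (a-colour ext) (b-colour b-coloured ext)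
      count-β : revealed st″ β ≡ suc (revealed st β)
      count-β = trans (revealed-reveal st′ v β v-h′)
                      (cong suc (revealed-reveal-≢ st a (not β) a-h (not-¬ refl ∘ sym)))
      count-¬β : revealed st″ (not β) ≡ suc (revealed st (not β))
      count-¬β = trans (revealed-reveal-≢ st′ v β v-h′ (not-¬ refl)) (revealed-reveal st a (not β) a-h)
      hidden-st : hidden st ≡ 2 + hidden st″
      hidden-st = trans (hidden-reveal st a (not β) a-h) (cong suc (hidden-reveal st′ v β v-h′))
      room′ : 1 ≤ hidden st″ ⊎ suc (revealed st β) ≡ revealed st (not β)
      room′ = map₁ (λ 3≤h → ≤-pred (≤-pred (subst (3 ≤_) hidden-st 3≤h))) room
      near : Near (revealed st β) (revealed st (not β))
      near = orient {P = Near} Near-sym (revealed st) β bal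

  members≥3 : ∀ (S : Subset n) → ∣ S ∣ ≡ k → 3 ≤ ∣ S ∣
  members≥3 S ∣S∣≡k = subst (3 ≤_) (sym ∣S∣≡k) 3≤k

  reply-to : ∀ {st q} → Balanced st → Holds st (suc q) → (Q : Query n k) → Reply st Q q
  reply-to {st} bal hold (S , ∣S∣≡k) with shape st S
  ... | hidden-and-revealed {a} {b} {β} a∈S a-h b∈S b-β with revealed st (not β) ≤? revealed st β
  ...   | Dec.yes ≤β = reply-reveal-one a∈S a-h b∈S b-β ≤β bal hold
  -- β is the rarer revealed colour: colouring a alone would unbalance, so a second hidden ball gets β.
  ...   | Dec.no ≰β with another-hidden st a-h (two≤hidden hold)
  ...     | v , v≢a , v-h =
    reply-reveal-two a∈S a-h v≢a v-h b∈S (inj₁ b-β)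
      (inj₂ (≤-antisym (≰⇒> ≰β) (proj₂ (orient {P = Near} Near-sym (revealed st) β bal)))) bal hold
  reply-to {st} bal hold (S , ∣S∣≡k) | all-hidden {a} a∈S all-h
    with another-member {S = S} a (≤-trans (n≤1+n 2) (members≥3 S ∣S∣≡k))
  ... | a′ , a′∈S , a′≢a =
    reply-reveal-two {β = false} a∈S (all-h a∈S) a′≢a (all-h a′∈S) a′∈S (inj₂ refl)
      (inj₁ (≤-trans (members≥3 S ∣S∣≡k) (members≤hidden st {S} all-h))) bal hold
  reply-to {st} bal hold (S , ∣S∣≡k) | both-colours b∈S b-t b′∈S b′-f =
    reply (no _ _) st id (λ ext → b∈S , b′∈S , λ e → t≢f (trans (sym (ext b-t)) (trans e (ext b′-f))))
      (bal , idle hold)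
    where t≢f : true ≢ false
          t≢f ()
  reply-to {st} bal hold (S , ∣S∣≡k) | monochrome all-β =
    reply yes st id (λ ext i j i∈S j∈S → trans (ext (all-β i∈S)) (sym (ext (all-β j∈S)))) (bal , idle hold)

  Defeats : Partial n → Strategy n k → ℕ → Set
  Defeats st T q = ∃ λ c → Extends st c × ¬ Works c T q

  adversary : ∀ (T : Strategy n k) q {st} → Balanced st → Holds st q → Defeats st T q
  adversary (leaf o)    q       bal hold = refute bal (proj₁ (leaf-ok hold)) (proj₂ (leaf-ok hold)) o
  adversary (query Q h) zero    {st} _ _ = complete st false , complete-extends st false , λ ()
  adversary (query Q h) (suc q) bal hold with reply-to bal hold Q
  ... | reply answer next refines valid (bal′ , hold′) with adversary (h answer) q bal′ hold′
  ...   | c , ext , fails = c , refines ext , λ works → fails (works answer (valid ext))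

  no-strategy : ∀ {q} → G 0 0 n q → (T : Strategy n k) → ¬ Solves T q
  no-strategy {q} g T solves with settle true (λ _ → nothing) (sum-replicate-zero n) (sum-replicate-zero n)
                                        (sum-ones n) (z≤n , z≤n) g
  ... | bal , hold with adversary T q {λ _ → nothing} bal hold
  ...   | c , _ , fails = fails (solves c)

2[1+q]≤1+u⇒1+2q≤u : ∀ q {u} → 2 * suc q ≤ suc u → suc (2 * q) ≤ u
2[1+q]≤1+u⇒1+2q≤u q {u} h = ≤-pred (subst (_≤ suc u) (*-suc 2 q) h)

2[1+q]≤2+u⇒2q≤u : ∀ q {u} → 2 * suc q ≤ 2 + u → 2 * q ≤ u
2[1+q]≤2+u⇒2q≤u q {u} h = ≤-pred (≤-pred (subst (_≤ 2 + u) (*-suc 2 q) h))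

2[1+q]≤u⇒2≤u : ∀ q {u} → 2 * suc q ≤ u → 2 ≤ u
2[1+q]≤u⇒2≤u q h = ≤-trans (*-monoʳ-≤ 2 (s≤s (z≤n {q}))) h

Budget : ℕ → ℕ → ℕ → ℕ → Set
Budget t f u q = 2 * suc q ≤ u

budget-invariant : AdversaryInvariant Budget
budget-invariant = record
  { swap       = id
  ; leaf-ok    = λ {q = q} h → ≤-trans (s≤s z≤n) (2[1+q]≤u⇒2≤u q h) , λ _ → 2[1+q]≤u⇒2≤u q h
  ; idle       = λ {q = q} h → ≤-trans (*-monoʳ-≤ 2 (n≤1+n (suc q))) h
  ; two≤hidden = λ {q = q} → 2[1+q]≤u⇒2≤u (suc q)
  ; reveal-one = λ {q = q} h → ≤-trans (n≤1+n _) (2[1+q]≤1+u⇒1+2q≤u (suc q) h)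
  ; reveal-two = λ {q = q} h _ → 2[1+q]≤2+u⇒2q≤u (suc q) h
  }

x+x+1≢2*m : ∀ m x → x + x + 1 ≢ 2 * m
x+x+1≢2*m m x e = even≢odd m x (trans (sym e) (as-odd x))
  where
    as-odd : ∀ x → x + x + 1 ≡ suc (2 * x)
    as-odd = solve-∀

EvenBudget : ℕ → ℕ → ℕ → ℕ → ℕ → Set
EvenBudget m t f u q = t + f + u ≡ 2 * m × 1 ≤ u × 2 * q ≤ u

even-invariant : ∀ m → AdversaryInvariant (EvenBudget m)
even-invariant m = record
  { swap       = λ {t} {f} {u} (e , 1≤u , h) → trans (cong (_+ u) (+-comm f t)) e , 1≤u , h
  ; leaf-ok    = λ {t} {u = u} (e , 1≤u , _) → 1≤u , λ { refl → balanced-leaf t u e 1≤u }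
  ; idle       = λ {q = q} (e , 1≤u , h) → e , 1≤u , ≤-trans (*-monoʳ-≤ 2 (n≤1+n q)) h
  ; two≤hidden = λ {q = q} (_ , _ , h) → 2[1+q]≤u⇒2≤u q h
  ; reveal-one = λ {t} {f} {u} {q} (e , _ , h) →
      trans (one-more t f u) e ,
      ≤-trans (s≤s z≤n) (2[1+q]≤1+u⇒1+2q≤u q h) , ≤-trans (n≤1+n _) (2[1+q]≤1+u⇒1+2q≤u q h)
  ; reveal-two = λ {t} {f} {u} {q} (e , _ , h) room →
      trans (two-more t f u) e , still-hidden t f u e room , 2[1+q]≤2+u⇒2q≤u q h
  }
  where
    balanced-leaf : ∀ t u → t + t + u ≡ 2 * m → 1 ≤ u → 2 ≤ u
    balanced-leaf t (suc zero)    e _ = ⊥-elim (x+x+1≢2*m m t e)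
    balanced-leaf t (suc (suc u)) e _ = s≤s (s≤s z≤n)
    one-more : ∀ t f u → t + suc f + u ≡ t + f + suc u
    one-more = solve-∀
    two-more : ∀ t f u → suc t + suc f + u ≡ t + f + (2 + u)
    two-more = solve-∀
    tilted : ∀ t → suc t + suc t + 1 ≡ t + suc t + 2
    tilted = solve-∀
    still-hidden : ∀ t f u → t + f + (2 + u) ≡ 2 * m → 1 ≤ u ⊎ suc t ≡ f → 1 ≤ u
    still-hidden t f u       e (inj₁ 1≤u)  = 1≤u
    still-hidden t _ zero    e (inj₂ refl) = ⊥-elim (x+x+1≢2*m m (suc t) (trans (tilted t) e))
    still-hidden t f (suc u) e (inj₂ _)    = s≤s z≤n

unsolvable : ∀ {n k q} → 3 ≤ k → 2 * suc q ≤ n → (T : Strategy n k) → ¬ Solves T q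
unsolvable 3≤k = Adversary.no-strategy 3≤k budget-invariant

unsolvable-even : ∀ {n k q m} → 3 ≤ k → n ≡ 2 * m → 1 ≤ n → 2 * q ≤ n →
                  (T : Strategy n k) → ¬ Solves T q
unsolvable-even {m = m} 3≤k n≡2m 1≤n 2q≤n = Adversary.no-strategy 3≤k (even-invariant m) (n≡2m , 1≤n , 2q≤n)

lemma4p1 : (k n : ℕ) → 3 ≤ k → 2 * k ∸ 3 ≤ n →
           (T : Strategy n k) (q : ℕ) → Solves T q →
           ((m : ℕ) → n ≡ 2 * m → m + 1 ≤ q) × ((m : ℕ) → n ≡ 2 * m + 1 → m ≤ q)
lemma4p1 k n 3≤k 2k∸3≤n T q solves = even-bound , odd-bound
  where
    1≤n : 1 ≤ n
    1≤n = ≤-trans (s≤s z≤n) (≤-trans (∸-monoˡ-≤ 3 (*-monoʳ-≤ 2 3≤k)) 2k∸3≤n)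
    even-bound : (m : ℕ) → n ≡ 2 * m → m + 1 ≤ q
    even-bound m n≡2m = ≮⇒≥ λ q<m+1 →
      unsolvable-even {m = m} 3≤k n≡2m 1≤n (2q≤n (m<1+n⇒m≤n (subst (q <_) (+-comm m 1) q<m+1))) T solves
      where
        2q≤n : q ≤ m → 2 * q ≤ n
        2q≤n q≤m = subst (2 * q ≤_) (sym n≡2m) (*-monoʳ-≤ 2 q≤m)
    odd-bound : (m : ℕ) → n ≡ 2 * m + 1 → m ≤ q
    odd-bound m n≡2m+1 = ≮⇒≥ λ q<m →
      unsolvable 3≤k (2[1+q]≤n (≤-trans (*-monoʳ-≤ 2 q<m) (m≤m+n (2 * m) 1))) T solves
      where
        2[1+q]≤n : 2 * suc q ≤ 2 * m + 1 → 2 * suc q ≤ n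
        2[1+q]≤n = subst (2 * suc q ≤_) (sym n≡2m+1)
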